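{- Let $c,k>0$ and let $U$ be a function assignment for $N^k$. Suppose that for every $p>0$ there are a finite $A\subseteq N^k$ and $E\subseteq N$ with $|E|=p$ and $E^k\subseteq A$ such that $U(A)$ has at most $c$ regressive values on $E^k$. Then for every $p>0$ there are a finite $A\subseteq N^k$ and $E\subseteq N$ with $|E|=p$ and $E^k\subseteq A$ such that $U(A)$ has at most $k^k$ regressive values on $E^k$; in fact, $k^k$ can be replaced by $\mathrm{ot}(k)$.
   Context: $N=\{0,1,\dots\}$. For $x\in N^k$, $\min(x)$ is its least and $|x|$ its largest coordinate. A function assignment for $N^k$ assigns to each finite $A\subseteq N^k$ a function $U(A):A\to A$. $y$ is a regressive value of $F$ on $B$ if $F(x)=y$ and $|y|<\min(x)$ for some $x\in B$. $x,y\in N^k$ have the same order type if $x_i<x_j\iff y_i<y_j$ for all $i,j$; $\mathrm{ot}(k)$ is the number of order types of elements of $N^k$. -}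

module Defs where

open import Data.Nat using (ℕ; zero; suc; _<_; _≤_; _⊔_; _⊓_; _^_)
open import Data.Fin using (Fin)
open import Data.Vec using (Vec; []; _∷_; lookup; foldr)
open import Data.List using (List; length)
open import Data.List.Membership.Propositional using (_∈_)
open import Data.List.Relation.Unary.Unique.Propositional using (Unique)
open import Data.List.Relation.Unary.AllPairs using (AllPairs)
open import Data.Product using (Σ; _×_; ∃-syntax)
open import Relation.Binary.PropositionalEquality using (_≡_)
open import Relation.Nullary using (¬_)
open import Function.Bundles using (_⇔_)

Pt : ℕ → Set
Pt k = Vec ℕ k

-- min(x): least coordinate (only used for k > 0; value 0 for k = 0 is irrelevant).
minPt : ∀ {k} → Pt k → ℕ
minPt [] = 0
minPt (x ∷ []) = x
minPt (x ∷ y ∷ ys) = x ⊓ minPt (y ∷ ys)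

maxPt : ∀ {k} → Pt k → ℕ
maxPt = foldr _ _⊔_ 0

FinSubset : ℕ → Set
FinSubset k = List (Pt k)

-- A function assignment for N^k: for each finite A, a function U(A) : A → A.
-- U A is given on all of N^k; only its values on A matter, and it maps A into A.
record FunAssign (k : ℕ) : Set where
  field
    U      : FinSubset k → Pt k → Pt k
    U-into : ∀ A x → x ∈ A → U A x ∈ A
open FunAssign public

InPow : ∀ {k} → List ℕ → Pt k → Set
InPow E x = ∀ i → lookup x i ∈ E

PowSub : ∀ {k} → List ℕ → FinSubset k → Set
PowSub {k} E A = ∀ (x : Pt k) → InPow E x → x ∈ A

RegValue : ∀ {k} → (Pt k → Pt k) → List ℕ → Pt k → Set
RegValue {k} F E y = ∃[ x ] (InPow E x × F x ≡ y × maxPt y < minPt x)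

AtMostRegValues : ∀ {k} → ℕ → (Pt k → Pt k) → List ℕ → Set
AtMostRegValues {k} c F E =
  Σ (List (Pt k)) λ L → length L ≤ c × (∀ y → RegValue F E y → y ∈ L)

SizedSet : ℕ → List ℕ → Set
SizedSet p E = Unique E × length E ≡ p

Prop : ∀ {k} → FunAssign k → ℕ → Set
Prop {k} 𝓤 c = ∀ p → 0 < p →
  Σ (FinSubset k) λ A → Σ (List ℕ) λ E →
    SizedSet p E × PowSub E A × AtMostRegValues c (U 𝓤 A) E

SameOT : ∀ {k} → Pt k → Pt k → Set
SameOT {k} x y = ∀ (i j : Fin k) →
  (lookup x i < lookup x j) ⇔ (lookup y i < lookup y j)

-- ot(k) ≡ n: there are exactly n order types, i.e. a list of n points of
-- pairwise different order types representing every order type.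
IsOt : ℕ → ℕ → Set
IsOt k n = Σ (List (Pt k)) λ L →
  length L ≡ n × AllPairs (λ x y → ¬ SameOT x y) L ×
  (∀ (x : Pt k) → ∃[ y ] (y ∈ L × SameOT x y))

-- Every x ∈ ℕ^k factors as s ∘ ρ with s an increasing m-tuple (m ≤ k) of its values, and points of the
-- same order type factor through the same pattern ρ. Applying the finite Ramsey theorem once for each of
-- the finitely many patterns, every large enough E ⊆ ℕ contains a p-element E′ on whose k-th power any
-- (c+1)-colouring, even one chosen afterwards, depends only on the order type. Take A and E from the
-- hypothesis with |E| that large, and colour x by the position of U(A)(x) in the list of at most c
-- regressive values (0 if it is not there). On E′^k, regressive points of the same order type then have
-- the same value, so there are at most ot(k) ≤ k^k regressive values.
-- Ramsey's theorem itself is proved by induction on the arity: first pass to a set on which the colour of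
-- a tuple depends only on its least element, then apply the pigeonhole principle.

module Submission where

open import Defs
open import Data.Nat using (ℕ; zero; suc; _<_; _≤_; _*_; _+_; _^_; z≤n; s≤s; _≟_; _<?_; _≤?_)
open import Data.Nat.Properties
  using ( <-trans; <-irrefl; <-asym; <-cmp; <⇒≢; ≤∧≢⇒<; <-≤-trans; ≤-trans; ≤-reflexive; n≤1+n; +-suc
        ; +-cancelˡ-<; +-monoˡ-<; ≰⇒>; m≤n⇒m⊓n≡m; ≤-decTotalOrder; module ≤-Reasoning)
open import Data.Fin using (Fin; toℕ) renaming (zero to fzero; suc to fsuc)
import Data.Fin as Fin
import Data.Fin.Properties as Fin
open import Data.Vec using (Vec; []; _∷_; lookup; head; replicate; tabulate; toList; map)
open import Data.Vec.Properties using (lookup∘tabulate; lookup-map; length-toList; ≡-dec)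
open import Data.Vec.Membership.Propositional using () renaming (_∈_ to _∈ᵥ_)
open import Data.Vec.Membership.Propositional.Properties using (∈-toList⁺; ∈-toList⁻) renaming (∈-lookup to ∈-lookupᵥ)
import Data.Vec.Relation.Unary.Any as Anyᵥ
import Data.Vec.Relation.Unary.Any.Properties as Anyᵥ
open import Data.Vec.Relation.Binary.Pointwise.Extensional using (ext; Pointwise-≡⇒≡)
open import Data.List
  using (List; []; _∷_; [_]; length; filter; take; deduplicate; cartesianProductWith; mapMaybe; upTo; allFin)
import Data.List as List
open import Data.List.Properties
  using (length-++; length-map; length-tabulate; length-take; length-deduplicate; length-mapMaybe; length-upTo)
open import Data.List.Sort ≤-decTotalOrder using (sort; sort-↭; sort-↗)
open import Data.List.Membership.Propositional using (_∈_; find; lose)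
open import Data.List.Membership.Propositional.Properties
  using (∈-filter⁺; ∈-filter⁻; ∈-map⁺; ∈-lookup; ∈-upTo⁺; ∈-allFin)
open import Data.List.Relation.Binary.Subset.Propositional using (_⊆_)
import Data.List.Relation.Binary.Sublist.Propositional as Sublist
import Data.List.Relation.Binary.Sublist.Propositional.Properties as Sublist
open import Data.List.Relation.Binary.Permutation.Propositional using (↭-sym; ↭⇒↭ₛ)
open import Data.List.Relation.Binary.Permutation.Propositional.Properties using (∈-resp-↭; ↭-length)
import Data.List.Relation.Binary.Permutation.Setoid.Properties as Perm
open import Data.List.Relation.Unary.Any using (here; there; index)
import Data.List.Relation.Unary.Any as Any
import Data.List.Relation.Unary.Any.Properties as Any
open import Data.List.Relation.Unary.All using (All; []; _∷_)
import Data.List.Relation.Unary.All as All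
open import Data.List.Relation.Unary.All.Properties using (all-filter)
open import Data.List.Relation.Unary.AllPairs using (AllPairs; []; _∷_)
import Data.List.Relation.Unary.AllPairs as AllPairs
import Data.List.Relation.Unary.AllPairs.Properties as AllPairs
open import Data.List.Relation.Unary.Unique.Propositional using (Unique)
open import Data.List.Relation.Unary.Unique.DecPropositional.Properties _≟_ using (deduplicate-!)
open import Data.List.Relation.Unary.Linked.Properties using (Linked⇒AllPairs)
open import Data.Maybe using (Maybe; just)
import Data.Maybe.Relation.Unary.Any as MaybeAny
open import Data.Product using (Σ; _×_; _,_; ∃-syntax; proj₁; proj₂; uncurry)
open import Data.Empty using (⊥-elim)
open import Function using (_∘_; id; _⇔_; mk⇔; Equivalence)
open import Function.Properties.Equivalence using (⇔-isEquivalence)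
open import Relation.Nullary using (Dec; yes; no; ¬_)
open import Relation.Nullary.Decidable using (¬?; _×-dec_)
open import Relation.Binary.Definitions using (Decidable; DecidableEquality; tri<; tri≈; tri>)
open import Relation.Binary.Structures using (IsEquivalence)
open import Relation.Binary.PropositionalEquality
  using (_≡_; _≢_; refl; sym; trans; cong; cong₂; subst; subst₂; setoid; module ≡-Reasoning)

-- Lists and the pigeonhole principle

Ascending : List ℕ → Set
Ascending = AllPairs _<_

sort-ascending : ∀ {xs} → Unique xs → Ascending (sort xs)
sort-ascending {xs} u = AllPairs.zipWith (uncurry ≤∧≢⇒<)
  (Linked⇒AllPairs ≤-trans (sort-↗ xs) , Perm.Unique-resp-↭ (setoid ℕ) (↭⇒↭ₛ (↭-sym (sort-↭ xs))) u)

∈-sort⁺ : ∀ {xs v} → v ∈ xs → v ∈ sort xs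
∈-sort⁺ {xs} = ∈-resp-↭ (↭-sym (sort-↭ xs))

∈-sort⁻ : ∀ {xs v} → v ∈ sort xs → v ∈ xs
∈-sort⁻ {xs} = ∈-resp-↭ (sort-↭ xs)

ascending-lookup : ∀ {xs} → Ascending xs → ∀ {i j} → i Fin.< j → List.lookup xs i < List.lookup xs j
ascending-lookup (x<xs ∷ _) {fzero} {fsuc j} _ = All.lookup x<xs (∈-lookup j)
ascending-lookup (_ ∷ asc) {fsuc i} {fsuc j} (s≤s i<j) = ascending-lookup asc i<j

∈-∷-above : ∀ {a v H} → a < v → v ∈ a ∷ H → v ∈ H
∈-∷-above a<v (here refl) = ⊥-elim (<-irrefl refl a<v)
∈-∷-above a<v (there v∈H) = v∈H

length-filter-complement : ∀ {A : Set} {P : A → Set} (P? : ∀ x → Dec (P x)) xs →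
  length (filter P? xs) + length (filter (¬? ∘ P?) xs) ≡ length xs
length-filter-complement P? [] = refl
length-filter-complement P? (x ∷ xs) with P? x
... | yes _ = cong suc (length-filter-complement P? xs)
... | no _ = trans (+-suc _ _) (cong suc (length-filter-complement P? xs))

pigeonhole : ∀ {A C : Set} (_≟_ : DecidableEquality C) (χ : A → C) p (cs : List C) xs →
  (∀ {x} → x ∈ xs → χ x ∈ cs) → length cs * p < length xs →
  ∃[ c ] p ≤ length (filter (λ x → χ x ≟ c) xs)
pigeonhole _≟_ χ p [] (x ∷ xs) colours _ with colours (here refl)
... | ()
pigeonhole _≟_ χ p (c ∷ cs) xs colours large with p ≤? length (filter (λ x → χ x ≟ c) xs)
... | yes enough = c , enough
... | no few with pigeonhole _≟_ χ p cs others others-colours others-large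
  where
  coloured = filter (λ x → χ x ≟ c) xs
  others = filter (λ x → ¬? (χ x ≟ c)) xs
  others-colours : ∀ {x} → x ∈ others → χ x ∈ cs
  others-colours x∈ with ∈-filter⁻ (λ x → ¬? (χ x ≟ c)) x∈
  ... | x∈xs , χx≢c with colours x∈xs
  ... | here χx≡c = ⊥-elim (χx≢c χx≡c)
  ... | there χx∈cs = χx∈cs
  others-large : length cs * p < length others
  others-large = +-cancelˡ-< (length coloured) _ _ (begin-strict
    length coloured + length cs * p  <⟨ +-monoˡ-< (length cs * p) (≰⇒> few) ⟩
    p + length cs * p                <⟨ large ⟩
    length xs                        ≡⟨ length-filter-complement (λ x → χ x ≟ c) xs ⟨
    length coloured + length others  ∎)
    where open ≤-Reasoning
... | c′ , enough = c′ , ≤-trans enough (Sublist.length-mono-≤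
        (Sublist.filter⁺ (λ x → χ x ≟ c′) (λ x → χ x ≟ c′) (λ { refl → id }) (Sublist.filter-⊆ _ xs)))

deduplicate-AllPairs : {A : Set} {R : A → A → Set} (R? : Decidable R) (xs : List A) →
  AllPairs (λ x y → ¬ R x y) (deduplicate R? xs)
deduplicate-AllPairs R? [] = []
deduplicate-AllPairs R? (x ∷ xs) =
  all-filter (¬? ∘ R? x) (deduplicate R? xs) ∷ AllPairs.filter⁺ (¬? ∘ R? x) (deduplicate-AllPairs R? xs)

∈-mapMaybe⁺ : {A B : Set} (f : A → Maybe B) {xs : List A} {x : A} {y : B} →
  x ∈ xs → f x ≡ just y → y ∈ mapMaybe f xs
∈-mapMaybe⁺ f {xs} {y = y} x∈xs fx≡y = Any.mapMaybe⁺ f xs (Any.map⁺ (Any.map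
  (λ { refl → subst (MaybeAny.Any (y ≡_)) (sym fx≡y) (MaybeAny.just refl) }) x∈xs))

head-∈ : {A : Set} {xs : List A} {x : A} → x ∈ xs → ∃[ z ] (List.head xs ≡ just z × z ∈ xs)
head-∈ {xs = z ∷ _} _ = z , refl , here refl

vectors : {A : Set} → List A → (n : ℕ) → List (Vec A n)
vectors xs zero = [ [] ]
vectors xs (suc n) = cartesianProductWith _∷_ xs (vectors xs n)

∈-vectors⁺ : {A : Set} {xs : List A} {n : ℕ} {v : Vec A n} → (∀ i → lookup v i ∈ xs) → v ∈ vectors xs n
∈-vectors⁺ {v = []} _ = here refl
∈-vectors⁺ {v = a ∷ v} v∈ = Any.cartesianProductWith⁺ _∷_ (λ { refl refl → refl }) (v∈ fzero) (∈-vectors⁺ (v∈ ∘ fsuc))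

∈-vectors⁻ : {A : Set} {xs : List A} {n : ℕ} {v : Vec A n} → v ∈ vectors xs n → ∀ i → lookup v i ∈ xs
∈-vectors⁻ {xs = xs} {suc n} {a ∷ v} v∈ i
  with Any.cartesianProductWith⁻ _∷_ {P = a ≡_} {Q = v ≡_} (λ { refl → refl , refl }) xs (vectors xs n) v∈ | i
... | a∈xs , _ | fzero = a∈xs
... | _ , v∈vectors | fsuc j = ∈-vectors⁻ v∈vectors j

length-cartesianProductWith : {A B C : Set} (f : A → B → C) (xs : List A) (ys : List B) →
  length (cartesianProductWith f xs ys) ≡ length xs * length ys
length-cartesianProductWith f [] ys = refl
length-cartesianProductWith f (x ∷ xs) ys = trans (length-++ (List.map (f x) ys))
  (cong₂ _+_ (length-map (f x) ys) (length-cartesianProductWith f xs ys))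

length-vectors : {A : Set} (xs : List A) (n : ℕ) → length (vectors xs n) ≡ length xs ^ n
length-vectors xs zero = refl
length-vectors xs (suc n) =
  trans (length-cartesianProductWith _∷_ xs (vectors xs n)) (cong (length xs *_) (length-vectors xs n))

override : {A : Set} → (ℕ → A) → ℕ → A → ℕ → A
override χ a κ v with v ≟ a
... | yes _ = κ
... | no _ = χ v

override-≡ : {A : Set} (χ : ℕ → A) (a : ℕ) (κ : A) → override χ a κ a ≡ κ
override-≡ χ a κ with a ≟ a
... | yes _ = refl
... | no a≢a = ⊥-elim (a≢a refl)

override-≢ : {A : Set} (χ : ℕ → A) {a : ℕ} (κ : A) {v : ℕ} → v ≢ a → override χ a κ v ≡ χ v
override-≢ χ {a} κ {v} v≢a with v ≟ a
... | yes v≡a = ⊥-elim (v≢a v≡a)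
... | no _ = refl

-- The finite Ramsey theorem

Increasing : ∀ {m} → Vec ℕ m → Set
Increasing s = ∀ {i j} → i Fin.< j → lookup s i < lookup s j

increasing-tail : ∀ {m x} {t : Vec ℕ m} → Increasing (x ∷ t) → Increasing t
increasing-tail inc i<j = inc (s≤s i<j)

increasing-head : ∀ {m x} {t : Vec ℕ m} → Increasing (x ∷ t) → ∀ j → x < lookup t j
increasing-head inc j = inc {fzero} {fsuc j} (s≤s z≤n)

Homogeneous : ∀ {m r} → (Vec ℕ m → Fin r) → List ℕ → Fin r → Set
Homogeneous {m} col H κ = ∀ (s : Vec ℕ m) → Increasing s → InPow H s → col s ≡ κ

Monochromatic : ∀ {m r} → (Vec ℕ m → Fin r) → List ℕ → Set
Monochromatic col H = ∃[ κ ] Homogeneous col H κ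

-- N must not depend on the colouring c: in the application the colouring is only known after N has been
-- used to choose A.
Ubiquitous : {C : Set} → (C → List ℕ → Set) → Set
Ubiquitous G = ∀ p → ∃[ N ] ∀ c E → Ascending E → N ≤ length E →
  ∃[ H ] (Ascending H × H ⊆ E × p ≤ length H × G c H)

Hereditary : {C : Set} → (C → List ℕ → Set) → Set
Hereditary G = ∀ {c H H′} → H′ ⊆ H → G c H → G c H′

homogeneous-⊆ : ∀ {m r} {col : Vec ℕ m → Fin r} {κ H H′} → H′ ⊆ H → Homogeneous col H κ → Homogeneous col H′ κ
homogeneous-⊆ H′⊆H hom s inc s∈H′ = hom s inc (H′⊆H ∘ s∈H′)

monochromatic-hereditary : ∀ {m r} → Hereditary (Monochromatic {m} {r})
monochromatic-hereditary H′⊆H (κ , hom) = κ , homogeneous-⊆ H′⊆H hom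

ubiquitous-map : {C C′ : Set} {G : C → List ℕ → Set} {G′ : C′ → List ℕ → Set} (f : C′ → C) →
  (∀ {c H} → G (f c) H → G′ c H) → Ubiquitous G → Ubiquitous G′
ubiquitous-map f G⇒G′ ub p with ub p
... | N , select = N , λ c E ascE N≤|E| → let H , ascH , H⊆E , p≤|H| , g = select (f c) E ascE N≤|E|
                                         in H , ascH , H⊆E , p≤|H| , G⇒G′ g

ubiquitous-All : {I C : Set} {G : I → C → List ℕ → Set} (is : List I) →
  (∀ i → Ubiquitous (G i)) → (∀ i → Hereditary (G i)) → Ubiquitous (λ c H → All (λ i → G i c H) is)
ubiquitous-All [] _ _ p = p , λ c E ascE p≤|E| → E , ascE , id , p≤|E| , []
ubiquitous-All {G = G} (i ∷ is) ub hered p with ubiquitous-All is ub hered p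
... | N , selectAll with ub i N
... | N′ , select = N′ , λ c E ascE N′≤|E| →
  let H , ascH , H⊆E , N≤|H| , gH = select c E ascE N′≤|E|
      H′ , ascH′ , H′⊆H , p≤|H′| , allH′ = selectAll c H ascH N≤|H|
  in H′ , ascH′ , H⊆E ∘ H′⊆H , p≤|H′| , hered i H′⊆H gH ∷ allH′

MinHomogeneous : ∀ {m r} → (Vec ℕ (suc m) → Fin r) → List ℕ → (ℕ → Fin r) → Set
MinHomogeneous {m} col H χ = ∀ (s : Vec ℕ (suc m)) → Increasing s → InPow H s → col s ≡ χ (head s)

minHomogeneous-∷ : ∀ {m r} {col : Vec ℕ (suc m) → Fin r} {a H κ χ} → All (a <_) H →
  Homogeneous (col ∘ (a ∷_)) H κ → MinHomogeneous col H χ → MinHomogeneous col (a ∷ H) (override χ a κ)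
minHomogeneous-∷ {col = col} {a} {H} {κ} {χ} a<H hom minHom (x ∷ t) inc s∈ with s∈ fzero
... | here refl = trans (hom t (increasing-tail inc) t∈H) (sym (override-≡ χ a κ))
  where
  t∈H : InPow H t
  t∈H j = ∈-∷-above (increasing-head inc j) (s∈ (fsuc j))
... | there x∈H = trans (minHom (x ∷ t) inc s∈H) (sym (override-≢ χ κ (λ { refl → <-irrefl refl a<x })))
  where
  a<x : a < x
  a<x = All.lookup a<H x∈H
  s∈H : InPow H (x ∷ t)
  s∈H fzero = x∈H
  s∈H (fsuc j) = ∈-∷-above (<-trans a<x (increasing-head inc j)) (s∈ (fsuc j))

minHomogeneous-ubiquitous : ∀ {m r} → Ubiquitous (Monochromatic {m} {r}) →
  Ubiquitous (λ (col : Vec ℕ (suc m) → Fin r) H → ∃[ χ ] MinHomogeneous col H χ)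
minHomogeneous-ubiquitous R zero = 0 , λ col E _ _ →
  -- H is empty, so any colour function will do.
  [] , [] , (λ ()) , z≤n , (λ _ → col (replicate _ 0)) , λ _ _ s∈[] → ⊥-elim (Any.¬Any[] (s∈[] fzero))
minHomogeneous-ubiquitous R (suc p) with minHomogeneous-ubiquitous R p
... | N , shrink with R N
... | N′ , homogenise = suc N′ , extend
  where
  extend : ∀ col E → Ascending E → suc N′ ≤ length E →
    ∃[ H ] (Ascending H × H ⊆ E × suc p ≤ length H × ∃[ χ ] MinHomogeneous col H χ)
  extend col (a ∷ E) (a<E ∷ ascE) (s≤s N′≤|E|)
    with homogenise (col ∘ (a ∷_)) E ascE N′≤|E|
  ... | S , ascS , S⊆E , N≤|S| , κ , homS with shrink col S ascS N≤|S|
  ... | H , ascH , H⊆S , p≤|H| , χ , minH =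
    a ∷ H , a<H ∷ ascH , ∷-⊆ , s≤s p≤|H| , override χ a κ , minHomogeneous-∷ a<H (homogeneous-⊆ H⊆S homS) minH
    where
    a<H : All (a <_) H
    a<H = All.tabulate (All.lookup a<E ∘ S⊆E ∘ H⊆S)
    ∷-⊆ : a ∷ H ⊆ a ∷ E
    ∷-⊆ (here refl) = here refl
    ∷-⊆ (there v∈H) = there (S⊆E (H⊆S v∈H))

ramsey : ∀ m r → Ubiquitous (Monochromatic {m} {r})
ramsey zero r p = p , λ col E ascE p≤|E| → E , ascE , id , p≤|E| , col [] , λ { [] _ _ → refl }
ramsey (suc m) r p with minHomogeneous-ubiquitous (ramsey m r) (suc (r * p))
... | N , minHomogenise = N , homogenise
  where
  homogenise : ∀ col E → Ascending E → N ≤ length E →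
    ∃[ H ] (Ascending H × H ⊆ E × p ≤ length H × Monochromatic col H)
  homogenise col E ascE N≤|E| with minHomogenise col E ascE N≤|E|
  ... | H , ascH , H⊆E , rp<|H| , χ , minH
    with pigeonhole Fin._≟_ χ p (allFin r) H (λ _ → ∈-allFin _)
           (subst (λ n → n * p < length H) (sym (length-tabulate {n = r} id)) rp<|H|)
  ... | κ , p≤|H̃| = H̃ , AllPairs.filter⁺ _ ascH , H⊆E ∘ H̃⊆H , p≤|H̃| , κ , hom
    where
    H̃ = filter (λ v → χ v Fin.≟ κ) H
    H̃⊆H : H̃ ⊆ H
    H̃⊆H = proj₁ ∘ ∈-filter⁻ (λ v → χ v Fin.≟ κ) {xs = H}
    χ≡κ : ∀ {v} → v ∈ H̃ → χ v ≡ κ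
    χ≡κ = proj₂ ∘ ∈-filter⁻ (λ v → χ v Fin.≟ κ) {xs = H}
    hom : Homogeneous col H̃ κ
    hom s@(_ ∷ _) inc s∈H̃ = trans (minH s inc (H̃⊆H ∘ s∈H̃)) (χ≡κ (s∈H̃ fzero))

-- Order types

module ⇔ {ℓ} = IsEquivalence (⇔-isEquivalence {ℓ})

sameOT-sym : ∀ {k} {x y : Pt k} → SameOT x y → SameOT y x
sameOT-sym x~y i j = ⇔.sym (x~y i j)

sameOT-trans : ∀ {k} {x y z : Pt k} → SameOT x y → SameOT y z → SameOT x z
sameOT-trans x~y y~z i j = ⇔.trans (x~y i j) (y~z i j)

⇔-dec : {A B : Set} → Dec A → Dec B → Dec (A ⇔ B)
⇔-dec (yes a) (yes b) = yes (mk⇔ (λ _ → b) (λ _ → a))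
⇔-dec (yes a) (no ¬b) = no (λ a⇔b → ¬b (Equivalence.to a⇔b a))
⇔-dec (no ¬a) (yes b) = no (λ a⇔b → ¬a (Equivalence.from a⇔b b))
⇔-dec (no ¬a) (no ¬b) = yes (mk⇔ (⊥-elim ∘ ¬a) (⊥-elim ∘ ¬b))

sameOT? : ∀ {k} → Decidable (SameOT {k})
sameOT? x y = Fin.all? λ i → Fin.all? λ j → ⇔-dec (lookup x i <? lookup x j) (lookup y i <? lookup y j)

sameOT-≡ : ∀ {k} {x y : Pt k} → SameOT x y → ∀ i j → lookup x i ≡ lookup x j → lookup y i ≡ lookup y j
sameOT-≡ {y = y} x~y i j xi≡xj with <-cmp (lookup y i) (lookup y j)
... | tri< yi<yj _ _ = ⊥-elim (<-irrefl xi≡xj (Equivalence.from (x~y i j) yi<yj))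
... | tri≈ _ yi≡yj _ = yi≡yj
... | tri> _ _ yj<yi = ⊥-elim (<-irrefl (sym xi≡xj) (Equivalence.from (x~y j i) yj<yi))

increasing-reflects : ∀ {m} {s : Vec ℕ m} → Increasing s → ∀ {a b} → lookup s a < lookup s b → a Fin.< b
increasing-reflects {s = s} inc {a} {b} sa<sb with Fin.<-cmp a b
... | tri< a<b _ _ = a<b
... | tri≈ _ refl _ = ⊥-elim (<-irrefl refl sa<sb)
... | tri> _ _ b<a = ⊥-elim (<-asym sa<sb (inc b<a))

instantiate : ∀ {k m} → Vec (Fin m) k → Vec ℕ m → Pt k
instantiate ρ s = map (lookup s) ρ

record Factorisation {k} (x : Pt k) (m : ℕ) (ρ : Vec (Fin m) k) : Set where
  field
    s           : Vec ℕ m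
    increasing  : Increasing s
    factors     : ∀ i → lookup x i ≡ lookup s (lookup ρ i)
    source      : Fin m → Fin k
    from-source : ∀ t → lookup s t ≡ lookup x (source t)

  x≡instantiate : x ≡ instantiate ρ s
  x≡instantiate = Pointwise-≡⇒≡ (ext λ i → trans (factors i) (sym (lookup-map i (lookup s) ρ)))

  s-inPow : ∀ {H} → InPow H x → InPow H s
  s-inPow x∈ t = subst (_∈ _) (sym (from-source t)) (x∈ (source t))

values : ∀ {k} → Pt k → List ℕ
values x = sort (deduplicate _≟_ (toList x))

∈-values⁺ : ∀ {k} (x : Pt k) i → lookup x i ∈ values x
∈-values⁺ x i = ∈-sort⁺ (Any.deduplicate⁺ _≟_ (λ z≡y v≡y → trans v≡y (sym z≡y)) (∈-toList⁺ (∈-lookupᵥ i x)))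

∈-values⁻ : ∀ {k} {x : Pt k} {v} → v ∈ values x → v ∈ᵥ x
∈-values⁻ = ∈-toList⁻ ∘ Any.deduplicate⁻ _≟_ ∘ ∈-sort⁻

values-ascending : ∀ {k} (x : Pt k) → Ascending (values x)
values-ascending x = sort-ascending (deduplicate-! (toList x))

length-values : ∀ {k} (x : Pt k) → length (values x) ≤ k
length-values {k} x = begin
  length (values x)                 ≡⟨ ↭-length (sort-↭ _) ⟩
  length (deduplicate _≟_ (toList x)) ≤⟨ length-deduplicate _≟_ (toList x) ⟩
  length (toList x)                 ≡⟨ length-toList x ⟩
  k                                 ∎
  where open ≤-Reasoning

factorise : ∀ {k} (x : Pt k) → ∃[ m ] (m ≤ k × Σ (Vec (Fin m) k) (Factorisation x m))
factorise x = length (values x) , length-values x , tabulate position , record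
  { s = s ; increasing = increasing ; factors = factors ; source = source ; from-source = from-source }
  where
  s = tabulate (List.lookup (values x))
  lookup-s : ∀ t → lookup s t ≡ List.lookup (values x) t
  lookup-s = lookup∘tabulate _
  position : _ → Fin (length (values x))
  position i = index (∈-values⁺ x i)
  increasing : Increasing s
  increasing {i} {j} i<j =
    subst₂ _<_ (sym (lookup-s i)) (sym (lookup-s j)) (ascending-lookup (values-ascending x) i<j)
  factors : ∀ i → lookup x i ≡ lookup s (lookup (tabulate position) i)
  factors i = begin
    lookup x i                               ≡⟨ Any.lookup-index (∈-values⁺ x i) ⟩
    List.lookup (values x) (position i)      ≡⟨ lookup-s (position i) ⟨
    lookup s (position i)                    ≡⟨ cong (lookup s) (lookup∘tabulate position i) ⟨
    lookup s (lookup (tabulate position) i)  ∎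
    where open ≡-Reasoning
  source : _ → _
  source t = Anyᵥ.index (∈-values⁻ (∈-lookup t))
  from-source : ∀ t → lookup s t ≡ lookup x (source t)
  from-source t = trans (lookup-s t) (Anyᵥ.lookup-index (∈-values⁻ (∈-lookup t)))

factorisation-transport : ∀ {k m ρ} {x y : Pt k} → SameOT x y → Factorisation x m ρ → Factorisation y m ρ
factorisation-transport {ρ = ρ} {x} {y} x~y f = record
  { s = s′ ; increasing = increasing ; factors = factors ; source = source ; from-source = lookup-s′ }
  where
  open Factorisation f using (s; source; from-source)
  s′ = tabulate (lookup y ∘ source)
  lookup-s′ : ∀ t → lookup s′ t ≡ lookup y (source t)
  lookup-s′ = lookup∘tabulate _
  increasing : Increasing s′
  increasing {i} {j} i<j = subst₂ _<_ (sym (lookup-s′ i)) (sym (lookup-s′ j))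
    (Equivalence.to (x~y (source i) (source j))
      (subst₂ _<_ (from-source i) (from-source j) (Factorisation.increasing f i<j)))
  factors : ∀ i → lookup y i ≡ lookup s′ (lookup ρ i)
  factors i = trans (sameOT-≡ {x = x} {y} x~y i (source (lookup ρ i)) x-coincides) (sym (lookup-s′ (lookup ρ i)))
    where
    x-coincides : lookup x i ≡ lookup x (source (lookup ρ i))
    x-coincides = trans (Factorisation.factors f i) (from-source (lookup ρ i))

factorisation-sameOT : ∀ {k m ρ} {x : Pt k} → Factorisation x m ρ → SameOT x (map toℕ ρ)
factorisation-sameOT {ρ = ρ} f i j = mk⇔
  (λ xi<xj → subst₂ _<_ (sym (lookup-map i toℕ ρ)) (sym (lookup-map j toℕ ρ))
               (increasing-reflects {s = s} increasing (subst₂ _<_ (factors i) (factors j) xi<xj)))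
  (λ ρi<ρj → subst₂ _<_ (sym (factors i)) (sym (factors j))
               (increasing (subst₂ _<_ (lookup-map i toℕ ρ) (lookup-map j toℕ ρ) ρi<ρj)))
  where open Factorisation f

RepresentsOrderTypes : ∀ {k} → List (Pt k) → Set
RepresentsOrderTypes {k} R = ∀ (x : Pt k) → ∃[ τ ] (τ ∈ R × SameOT x τ)

otRepresentatives : ∀ k → List (Pt k)
otRepresentatives k = deduplicate sameOT? (vectors (upTo k) k)

otRepresentatives-complete : ∀ {k} → RepresentsOrderTypes (otRepresentatives k)
otRepresentatives-complete x with factorise x
... | _ , m≤k , ρ , f =
  find (Any.deduplicate⁺ sameOT? (λ {y} {z} → respects {y} {z})
    (lose {P = SameOT x} {x = map toℕ ρ} (∈-vectors⁺ ρ-in-range) (factorisation-sameOT f)))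
  where
  respects : ∀ {y z} → SameOT z y → SameOT x y → SameOT x z
  respects {y} {z} z~y x~y = sameOT-trans {x = x} {y} {z} x~y (sameOT-sym {x = z} {y} z~y)
  ρ-in-range : ∀ i → lookup (map toℕ ρ) i ∈ upTo _
  ρ-in-range i = subst (_∈ _) (sym (lookup-map i toℕ ρ)) (∈-upTo⁺ (<-≤-trans (Fin.toℕ<n (lookup ρ i)) m≤k))

otRepresentatives-isOt : ∀ k → IsOt k (length (otRepresentatives k))
otRepresentatives-isOt k = otRepresentatives k , refl , deduplicate-AllPairs sameOT? _ , otRepresentatives-complete

length-otRepresentatives : ∀ k → length (otRepresentatives k) ≤ k ^ k
length-otRepresentatives k = ≤-trans (length-deduplicate sameOT? (vectors (upTo k) k))
  (≤-reflexive (trans (length-vectors (upTo k) k) (cong (_^ k) (length-upTo k))))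

PatternHomogeneous : ∀ {k r} → (Pt k → Fin r) → List ℕ → Set
PatternHomogeneous {k} col H = ∀ {m} → m ≤ k → (ρ : Vec (Fin m) k) → Monochromatic (col ∘ instantiate ρ) H

patternHomogeneous-ubiquitous : ∀ k r → Ubiquitous (PatternHomogeneous {k} {r})
patternHomogeneous-ubiquitous k r = ubiquitous-map id
  (λ hom {m} m≤k ρ → All.lookup (All.lookup hom (∈-upTo⁺ (s≤s m≤k))) (∈-vectors⁺ (λ _ → ∈-allFin _)))
  (ubiquitous-All (upTo (suc k))
    (λ m → ubiquitous-All (vectors (allFin m) k) (λ ρ → ubiquitous-map (_∘ instantiate ρ) id (ramsey m r))
                 (λ _ → monochromatic-hereditary))
    (λ _ H′⊆H → All.map (monochromatic-hereditary H′⊆H)))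

patternHomogeneous-sameOT : ∀ {k r} {col : Pt k → Fin r} {H x y} → PatternHomogeneous col H →
  InPow H x → InPow H y → SameOT x y → col x ≡ col y
patternHomogeneous-sameOT {col = col} hom x∈H y∈H x~y with factorise _
... | _ , m≤k , ρ , fx with hom m≤k ρ | factorisation-transport x~y fx
... | κ , homρ | fy = trans (colour fx x∈H) (sym (colour fy y∈H))
  where
  colour : ∀ {z} (f : Factorisation z _ ρ) → InPow _ z → col z ≡ κ
  colour f z∈H = trans (cong col (Factorisation.x≡instantiate f))
    (homρ (Factorisation.s f) (Factorisation.increasing f) (Factorisation.s-inPow f z∈H))

-- Regressive values

Regressive : ∀ {k} → (Pt k → Pt k) → Pt k → Set
Regressive F x = maxPt (F x) < minPt x

module _ {k : ℕ} where
  open import Data.List.Membership.DecPropositional (≡-dec {n = k} _≟_) using (_∈?_)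

  code : ∀ {c} (L : List (Pt k)) → length L ≤ c → Pt k → Fin (suc c)
  code L |L|≤c y with y ∈? L
  ... | yes y∈L = fsuc (Fin.inject≤ (index y∈L) |L|≤c)
  ... | no _ = fzero

  code-injective : ∀ {c} (L : List (Pt k)) (|L|≤c : length L ≤ c) {y y′} → y ∈ L → y′ ∈ L →
    code L |L|≤c y ≡ code L |L|≤c y′ → y ≡ y′
  code-injective L |L|≤c {y} {y′} y∈L y′∈L same with y ∈? L | y′ ∈? L
  ... | yes p | yes q = begin
    y                          ≡⟨ Any.lookup-index p ⟩
    List.lookup L (index p)    ≡⟨ cong (List.lookup L) (Fin.inject≤-injective _ _ _ _ (Fin.suc-injective same)) ⟩
    List.lookup L (index q)    ≡⟨ Any.lookup-index q ⟨
    y′                         ∎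
    where open ≡-Reasoning
  ... | no y∉L | _ = ⊥-elim (y∉L y∈L)
  ... | yes _ | no y′∉L = ⊥-elim (y′∉L y′∈L)

atMostRegValues-orderTypes : ∀ {k} (F : Pt k → Pt k) (E : List ℕ) (R : List (Pt k)) →
  RepresentsOrderTypes R →
  (∀ {x z} → InPow E x → InPow E z → Regressive F x → Regressive F z → SameOT x z → F x ≡ F z) →
  AtMostRegValues (length R) F E
atMostRegValues-orderTypes {k} F E R complete determined =
  List.map F (mapMaybe witness R) ,
  ≤-trans (≤-reflexive (length-map F (mapMaybe witness R))) (length-mapMaybe witness R) ,
  covers
  where
  Witness : Pt k → Pt k → Set
  Witness τ z = SameOT τ z × Regressive F z
  witness? : ∀ τ z → Dec (Witness τ z)
  witness? τ z = sameOT? τ z ×-dec (maxPt (F z) <? minPt z)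
  witness : Pt k → Maybe (Pt k)
  witness τ = List.head (filter (witness? τ) (vectors E k))
  covers : ∀ y → RegValue F E y → y ∈ List.map F (mapMaybe witness R)
  covers _ (x , x∈E , refl , reg) with complete x
  ... | τ , τ∈R , x~τ
    with head-∈ (∈-filter⁺ (witness? τ) (∈-vectors⁺ x∈E) (sameOT-sym {x = x} {τ} x~τ , reg))
  ... | z , found , z∈filtered with ∈-filter⁻ (witness? τ) z∈filtered
  ... | z∈Eᵏ , τ~z , regz = subst (_∈ List.map F (mapMaybe witness R))
    (determined {z} {x} (∈-vectors⁻ z∈Eᵏ) x∈E regz reg z~x) (∈-map⁺ F (∈-mapMaybe⁺ witness τ∈R found))
    where
    z~x : SameOT z x
    z~x = sameOT-sym {x = x} {z} (sameOT-trans {x = x} {τ} {z} x~τ τ~z)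

prop-mono : ∀ {k} (𝓤 : FunAssign k) {n n′} → n ≤ n′ → Prop 𝓤 n → Prop 𝓤 n′
prop-mono 𝓤 n≤n′ hyp p p>0 with hyp p p>0
... | A , E , sized , E^k⊆A , L , |L|≤n , covers = A , E , sized , E^k⊆A , L , ≤-trans |L|≤n n≤n′ , covers

prop-orderTypes : ∀ {k c} (𝓤 : FunAssign k) (R : List (Pt k)) →
  RepresentsOrderTypes R → Prop 𝓤 c → Prop 𝓤 (length R)
prop-orderTypes {k} {c} 𝓤 R complete hyp p _ with patternHomogeneous-ubiquitous k (suc c) p
... | N , homogenise with hyp (suc N) (s≤s z≤n) -- suc N only to meet the side condition 0 < p
... | A , E , (uniqueE , |E|≡1+N) , E^k⊆A , L , |L|≤c , L-covers
  with homogenise (code L |L|≤c ∘ U 𝓤 A) (sort E) (sort-ascending uniqueE)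
         (≤-trans (n≤1+n N) (≤-reflexive (trans (sym |E|≡1+N) (sym (↭-length (sort-↭ E))))))
... | H , ascH , H⊆sortE , p≤|H| , hom =
  A , E′ , (AllPairs.map <⇒≢ (AllPairs.take⁺ p ascH) , trans (length-take p H) (m≤n⇒m⊓n≡m p≤|H|)) ,
  (λ x x∈E′ → E^k⊆A x (E′⊆E ∘ x∈E′)) ,
  atMostRegValues-orderTypes F E′ R complete determined
  where
  F = U 𝓤 A
  E′ = take p H
  E′⊆H : E′ ⊆ H
  E′⊆H = Sublist.lookup (Sublist.take-⊆ p H)
  E′⊆E : E′ ⊆ E
  E′⊆E = ∈-sort⁻ ∘ H⊆sortE ∘ E′⊆H
  determined : ∀ {x z} → InPow E′ x → InPow E′ z → Regressive F x → Regressive F z → SameOT x z → F x ≡ F z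
  determined {x} {z} x∈E′ z∈E′ regx regz x~z =
    code-injective L |L|≤c
      (L-covers (F x) (x , E′⊆E ∘ x∈E′ , refl , regx)) (L-covers (F z) (z , E′⊆E ∘ z∈E′ , refl , regz))
      (patternHomogeneous-sameOT {col = code L |L|≤c ∘ F} {x = x} {z} hom (E′⊆H ∘ x∈E′) (E′⊆H ∘ z∈E′) x~z)

lemma3p12 : ∀ (c k : ℕ) → 0 < c → 0 < k → (𝓤 : FunAssign k) →
    Prop 𝓤 c →
    Prop 𝓤 (k ^ k) × (∃[ n ] (IsOt k n × Prop 𝓤 n))
lemma3p12 c k _ _ 𝓤 hyp =
  prop-mono 𝓤 (length-otRepresentatives k) otBound ,
  length (otRepresentatives k) , otRepresentatives-isOt k , otBound
  where
  otBound : Prop 𝓤 (length (otRepresentatives k))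
  otBound = prop-orderTypes 𝓤 (otRepresentatives k) otRepresentatives-complete hyp
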